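{- Let $n$ be an integer with $0\le n\le 8$. Then $\delta(n)\le 8/(16-n)$. Moreover, a periodic set $S\subseteq\mathbb{Z}^2$ with $N_S(x)\le n$ for all $x\in S$ has density $8/(16-n)$ if and only if $N_S(y)=8$ for every $y\in\mathbb{Z}^2\setminus S$ (i.e. no two elements of $\mathbb{Z}^2\setminus S$ are neighbors) and $N_S(x)=n$ for every $x\in S$.
   Context: Two points $x\neq y$ of $\mathbb{Z}^2$ are neighbors if $|x_i-y_i|\le 1$ for $i=1,2$. For $S\subseteq\mathbb{Z}^2$, $N_S(x)$ is the number of neighbors of $x$ in $S$. Let ${\sf B}_r=\{x\in\mathbb{Z}^2:|x_1|,|x_2|<r\}$; the upper density of $S$ is $\limsup_{r\to\infty}|{\sf B}_r\cap S|/|{\sf B}_r|$, and the density is the limit when it exists. $S$ is periodic if invariant under translation by a finite-index subgroup of $\mathbb{Z}^2$. $\delta(n)$ is the supremum of upper densities of sets $S\subseteq\mathbb{Z}^2$ with $N_S(x)\le n$ for all $x\in S$. -}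

module Defs where

open import Data.Nat using (ℕ; zero; suc; _+_; _*_; _≤_; _∸_)
open import Data.Integer as ℤ using (ℤ; +_; -[1+_]; _-_)
open import Data.Bool using (Bool; true; false; if_then_else_)
open import Data.List using (List; []; _∷_; map; upTo)
open import Data.Nat.ListAction using (sum)
open import Data.Product using (_×_; _,_; ∃; ∃-syntax)
open import Relation.Binary.PropositionalEquality using (_≡_; _≢_)

SubsetZ² : Set
SubsetZ² = ℤ → ℤ → Bool

bit : Bool → ℕ
bit b = if b then 1 else 0

offsets : List (ℤ × ℤ)
offsets =
  (-[1+ 0 ] , -[1+ 0 ]) ∷ (-[1+ 0 ] , + 0) ∷ (-[1+ 0 ] , + 1) ∷
  (+ 0 , -[1+ 0 ]) ∷ (+ 0 , + 1) ∷
  (+ 1 , -[1+ 0 ]) ∷ (+ 1 , + 0) ∷ (+ 1 , + 1) ∷ []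

N : SubsetZ² → ℤ → ℤ → ℕ
N S x₁ x₂ = sum (map (λ { (a , b) → bit (S (x₁ ℤ.+ a) (x₂ ℤ.+ b)) }) offsets)

coords : ℕ → List ℤ
coords m = map (λ i → (+ i) - (+ m)) (upTo (suc (m + m)))

-- |B_{m+1} ∩ S| where B_{m+1} = {x : |x₁|,|x₂| < m+1} = [-m,m]²
count : SubsetZ² → ℕ → ℕ
count S m = sum (map (λ x₁ → sum (map (λ x₂ → bit (S x₁ x₂)) (coords m))) (coords m))

boxSize : ℕ → ℕ
boxSize m = suc (m + m) * suc (m + m)

-- "upper density of S ≤ p/q" (q > 0), i.e. limsup_r |B_r ∩ S|/|B_r| ≤ p/q, written as:
-- for every k, eventually |B_r ∩ S|/|B_r| ≤ p/q + 1/(k+1)   (cross-multiplied)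
UpperDensity≤ : SubsetZ² → ℕ → ℕ → Set
UpperDensity≤ S p q =
  ∀ (k : ℕ) → ∃[ R ] ∀ (m : ℕ) → R ≤ m →
    suc k * q * count S m ≤ suc k * p * boxSize m + q * boxSize m

-- "S has density p/q" (q > 0): lim_r |B_r ∩ S|/|B_r| = p/q, i.e.
-- for every k, eventually | |B_r ∩ S|/|B_r| - p/q | ≤ 1/(k+1)
HasDensity : SubsetZ² → ℕ → ℕ → Set
HasDensity S p q =
  ∀ (k : ℕ) → ∃[ R ] ∀ (m : ℕ) → R ≤ m →
    (suc k * q * count S m ≤ suc k * p * boxSize m + q * boxSize m) ×
    (suc k * p * boxSize m ≤ suc k * q * count S m + q * boxSize m)

InvariantUnder : SubsetZ² → ℤ × ℤ → Set
InvariantUnder S (a , b) = ∀ x₁ x₂ → S (x₁ ℤ.+ a) (x₂ ℤ.+ b) ≡ S x₁ x₂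

-- S is periodic: invariant under a finite-index subgroup of ℤ², i.e. under the subgroup
-- generated by two linearly independent vectors u, v (every finite-index subgroup of ℤ²
-- is of this form, and any such subgroup has finite index |det(u,v)|).
Periodic : SubsetZ² → Set
Periodic S = ∃[ a ] ∃[ b ] ∃[ c ] ∃[ d ]
  ((a ℤ.* d - b ℤ.* c) ≢ + 0 × InvariantUnder S (a , b) × InvariantUnder S (c , d))

-- Count the pairs (x, y) of neighbours with x ∈ S and y ∉ S.  A point of S has
-- 8 − N_S(x) ≥ 8 − n neighbours outside S, and a point outside S has at most 8 neighbours in S.
-- Summed over a box this gives (8 − n)|S ∩ B_r| ≤ 8|B_{r+1} ∖ S|, that is
-- (16 − n)|S ∩ B_r| ≤ 8|B_{r+1}|, which is the density bound.  A periodic S has a square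
-- period D, and on the D × D torus the pairs are counted exactly:
-- (8 − n)σ ≤ #pairs ≤ 8(D² − σ), where σ = |S ∩ [0, D)²| and S has density σ/D².
-- So S has density 8/(16 − n) iff both inequalities are equalities, i.e. iff every point of S
-- has exactly n neighbours in S and every point outside S has all 8 neighbours in S.

module Submission where

open import Defs
open import Data.Nat
open import Data.Nat.Properties
open import Data.Nat.DivMod using (_/_; _%_; m≡m%n+[m/n]*n; m%n<n; m/n*n≤m)
open import Data.Nat.Tactic.RingSolver using (solve-∀)
open import Data.Integer as ℤ using (ℤ; +_; -[1+_])
import Data.Integer.Properties as ℤP
import Data.Integer.Tactic.RingSolver as ℤSolver
open import Data.Integer.DivMod using (_%ℕ_; _/ℕ_; n%ℕd<d; a≡a%ℕn+[a/ℕn]*n)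
open import Data.Bool using (true; false; not)
open import Data.List using (List; []; _∷_; length; map; applyUpTo)
open import Data.Nat.ListAction using (sum)
open import Data.List.Relation.Unary.All using (All; []; _∷_)
open import Data.Product using (_×_; _,_; ∃-syntax; proj₁; proj₂)
open import Data.Product.Function.NonDependent.Propositional using (_×-⇔_)
open import Data.Empty using (⊥-elim)
open import Function using (_∘_)
open import Function.Bundles using (_⇔_; mk⇔)
import Function.Properties.Equivalence as ⇔
open import Relation.Binary using (tri<; tri≈; tri>)
open import Relation.Binary.PropositionalEquality
open import Relation.Nullary using (contradiction; yes; no)

-- Finite sums over ranges, intervals and squares

∑ : ℕ → (ℕ → ℕ) → ℕ
∑ zero    f = 0
∑ (suc n) f = f 0 + ∑ n (f ∘ suc)

∑-cong : ∀ n {f g : ℕ → ℕ} → (∀ i → f i ≡ g i) → ∑ n f ≡ ∑ n g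
∑-cong zero    f≗g = refl
∑-cong (suc n) f≗g = cong₂ _+_ (f≗g 0) (∑-cong n (f≗g ∘ suc))

∑-mono : ∀ n {f g : ℕ → ℕ} → (∀ i → f i ≤ g i) → ∑ n f ≤ ∑ n g
∑-mono zero    f≤g = z≤n
∑-mono (suc n) f≤g = +-mono-≤ (f≤g 0) (∑-mono n (f≤g ∘ suc))

∑-distrib-+ : ∀ n (f g : ℕ → ℕ) → ∑ n (λ i → f i + g i) ≡ ∑ n f + ∑ n g
∑-distrib-+ zero    f g = refl
∑-distrib-+ (suc n) f g = trans (cong (λ z → f 0 + g 0 + z) (∑-distrib-+ n (f ∘ suc) (g ∘ suc)))
                                (+-interchange (f 0) (g 0) _ _)
  where
  +-interchange : ∀ a b c d → a + b + (c + d) ≡ a + c + (b + d)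
  +-interchange = solve-∀

∑-distribˡ-* : ∀ n k (f : ℕ → ℕ) → ∑ n (λ i → k * f i) ≡ k * ∑ n f
∑-distribˡ-* zero    k f = sym (*-zeroʳ k)
∑-distribˡ-* (suc n) k f =
  trans (cong (λ z → k * f 0 + z) (∑-distribˡ-* n k (f ∘ suc))) (sym (*-distribˡ-+ k (f 0) _))

∑-const : ∀ n k → ∑ n (λ _ → k) ≡ n * k
∑-const zero    k = refl
∑-const (suc n) k = cong (λ z → k + z) (∑-const n k)

∑-split : ∀ m n (f : ℕ → ℕ) → ∑ (m + n) f ≡ ∑ m f + ∑ n (λ i → f (m + i))
∑-split zero    n f = refl
∑-split (suc m) n f = trans (cong (λ z → f 0 + z) (∑-split m n (f ∘ suc))) (sym (+-assoc (f 0) _ _))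

∑-snoc : ∀ n (f : ℕ → ℕ) → ∑ (suc n) f ≡ ∑ n f + f n
∑-snoc zero    f = +-comm (f 0) 0
∑-snoc (suc n) f = trans (cong (λ z → f 0 + z) (∑-snoc n (f ∘ suc))) (sym (+-assoc (f 0) _ _))

+-≤-tight : ∀ {a b c d} → a ≤ c → b ≤ d → a + b ≡ c + d → a ≡ c × b ≡ d
+-≤-tight {a} {b} {c} {d} a≤c b≤d eq = a≡c , +-cancelˡ-≡ a b d (trans eq (cong (_+ d) (sym a≡c)))
  where
  a≡c : a ≡ c
  a≡c = ≤-antisym a≤c (+-cancelʳ-≤ b c a (≤-trans (+-monoʳ-≤ c b≤d) (≤-reflexive (sym eq))))

∑-≡⇒≗ : ∀ n {f g : ℕ → ℕ} → (∀ i → f i ≤ g i) → ∑ n f ≡ ∑ n g → ∀ i → i < n → f i ≡ g i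
∑-≡⇒≗ (suc n) f≤g eq zero    _         = proj₁ (+-≤-tight (f≤g 0) (∑-mono n (f≤g ∘ suc)) eq)
∑-≡⇒≗ (suc n) f≤g eq (suc i) (s≤s i<n) =
  ∑-≡⇒≗ n (f≤g ∘ suc) (proj₂ (+-≤-tight (f≤g 0) (∑-mono n (f≤g ∘ suc)) eq)) i i<n

∑-mono-length : ∀ {m n} (f : ℕ → ℕ) → m ≤ n → ∑ m f ≤ ∑ n f
∑-mono-length {m} {n} f m≤n = begin
  ∑ m f                                ≤⟨ m≤m+n (∑ m f) _ ⟩
  ∑ m f + ∑ (n ∸ m) (λ i → f (m + i))  ≡⟨ ∑-split m (n ∸ m) f ⟨
  ∑ (m + (n ∸ m)) f                    ≡⟨ cong (λ k → ∑ k f) (m+[n∸m]≡n m≤n) ⟩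
  ∑ n f                                ∎
  where open ≤-Reasoning

shift-invariant⇒constant : ∀ {A : Set} (h : ℤ → A) → (∀ z → h (z ℤ.+ + 1) ≡ h z) → ∀ z → h z ≡ h (+ 0)
shift-invariant⇒constant h step (+ zero)  = refl
shift-invariant⇒constant h step (+ suc k) =
  trans (cong h (cong +_ (+-comm 1 k))) (trans (step (+ k)) (shift-invariant⇒constant h step (+ k)))
shift-invariant⇒constant h step -[1+ zero ]  = sym (step -[1+ 0 ])
shift-invariant⇒constant h step -[1+ suc k ] =
  trans (sym (step -[1+ suc k ])) (shift-invariant⇒constant h step -[1+ k ])

intervalSum : ℤ → ℕ → (ℤ → ℕ) → ℕ
intervalSum a L g = ∑ L (λ i → g (a ℤ.+ + i))

intervalSum-≤-const : ∀ a L M (g : ℤ → ℕ) → (∀ x → g x ≤ M) → intervalSum a L g ≤ L * M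
intervalSum-≤-const a L M g g≤M = ≤-trans (∑-mono L (λ i → g≤M _)) (≤-reflexive (∑-const L M))

intervalSum-translate : ∀ a L u (g : ℤ → ℕ) → intervalSum a L (λ x → g (x ℤ.+ u)) ≡ intervalSum (a ℤ.+ u) L g
intervalSum-translate a L u g = ∑-cong L (λ i → cong g (swap a (+ i) u))
  where
  swap : ∀ a i u → a ℤ.+ i ℤ.+ u ≡ a ℤ.+ u ℤ.+ i
  swap = ℤSolver.solve-∀

intervalSum-split : ∀ a L L' (g : ℤ → ℕ) →
  intervalSum a (L + L') g ≡ intervalSum a L g + intervalSum (a ℤ.+ + L) L' g
intervalSum-split a L L' g = trans (∑-split L L' _)
  (cong (λ z → intervalSum a L g + z) (∑-cong L' (λ i → cong g (reassoc i))))
  where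
  reassoc : ∀ i → a ℤ.+ + (L + i) ≡ a ℤ.+ + L ℤ.+ + i
  reassoc i = trans (cong (λ z → a ℤ.+ z) (ℤP.pos-+ L i)) (sym (ℤP.+-assoc a (+ L) (+ i)))

intervalSum-mono-⊆ : ∀ a c L L' (g : ℤ → ℕ) → c + L ≤ L' → intervalSum (a ℤ.+ + c) L g ≤ intervalSum a L' g
intervalSum-mono-⊆ a c L L' g c+L≤L' = begin
  intervalSum (a ℤ.+ + c) L g                      ≤⟨ m≤n+m _ _ ⟩
  intervalSum a c g + intervalSum (a ℤ.+ + c) L g  ≡⟨ intervalSum-split a c L g ⟨
  intervalSum a (c + L) g                          ≤⟨ ∑-mono-length _ c+L≤L' ⟩
  intervalSum a L' g                               ∎
  where open ≤-Reasoning

module _ (D : ℕ) (g : ℤ → ℕ) (periodic : ∀ x → g (x ℤ.+ + D) ≡ g x) where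

  intervalSum-periodic : ∀ a → intervalSum a D g ≡ intervalSum (+ 0) D g
  intervalSum-periodic = shift-invariant⇒constant (λ a → intervalSum a D g) step
    where
    step : ∀ a → intervalSum (a ℤ.+ + 1) D g ≡ intervalSum a D g
    step a = +-cancelʳ-≡ (g a) _ _ (begin
      intervalSum (a ℤ.+ + 1) D g + g a               ≡⟨ cong₂ _+_ (∑-cong D (λ i → cong g (ℤP.+-assoc a (+ 1) (+ i))))
                                                                     (cong g (sym (ℤP.+-identityʳ a))) ⟩
      ∑ D (λ i → g (a ℤ.+ + suc i)) + g (a ℤ.+ + 0)   ≡⟨ +-comm _ (g (a ℤ.+ + 0)) ⟩
      ∑ (suc D) (λ i → g (a ℤ.+ + i))                 ≡⟨ ∑-snoc D _ ⟩
      intervalSum a D g + g (a ℤ.+ + D)               ≡⟨ cong (λ z → intervalSum a D g + z) (periodic a) ⟩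
      intervalSum a D g + g a                         ∎)
      where open ≡-Reasoning

  intervalSum-periods : ∀ a q → intervalSum a (q * D) g ≡ q * intervalSum (+ 0) D g
  intervalSum-periods a zero    = refl
  intervalSum-periods a (suc q) = begin
    intervalSum a (D + q * D) g                              ≡⟨ intervalSum-split a D (q * D) g ⟩
    intervalSum a D g + intervalSum (a ℤ.+ + D) (q * D) g    ≡⟨ cong₂ _+_ (intervalSum-periodic a)
                                                                          (intervalSum-periods (a ℤ.+ + D) q) ⟩
    intervalSum (+ 0) D g + q * intervalSum (+ 0) D g        ∎
    where open ≡-Reasoning

  intervalSum-periodic-bounds : .{{_ : NonZero D}} → ∀ M → (∀ x → g x ≤ M) → ∀ a L →
    L / D * intervalSum (+ 0) D g ≤ intervalSum a L g ×
    intervalSum a L g ≤ L / D * intervalSum (+ 0) D g + D * M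
  intervalSum-periodic-bounds M g≤M a L = ≤-trans (m≤n+m _ _) (≤-reflexive (sym split)) , (begin
    intervalSum a L g                      ≡⟨ split ⟩
    intervalSum a r g + q * P              ≤⟨ +-monoˡ-≤ (q * P) (≤-trans (intervalSum-≤-const a r M g g≤M)
                                                                         (*-monoˡ-≤ M (<⇒≤ (m%n<n L D)))) ⟩
    D * M + q * P                          ≡⟨ +-comm (D * M) (q * P) ⟩
    q * P + D * M                          ∎)
    where
    open ≤-Reasoning
    q = L / D
    r = L % D
    P = intervalSum (+ 0) D g
    split : intervalSum a L g ≡ intervalSum a r g + q * P
    split = trans (cong (λ k → intervalSum a k g) (m≡m%n+[m/n]*n L D))
            (trans (intervalSum-split a r (q * D) g)
                   (cong (λ z → intervalSum a r g + z) (intervalSum-periods (a ℤ.+ + r) q)))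

squareSum : ℤ → ℕ → (ℤ → ℤ → ℕ) → ℕ
squareSum a L F = intervalSum a L (λ x → intervalSum a L (F x))

module _ (a : ℤ) (L : ℕ) where

  squareSum-cong : {F G : ℤ → ℤ → ℕ} → (∀ x y → F x y ≡ G x y) → squareSum a L F ≡ squareSum a L G
  squareSum-cong F≗G = ∑-cong L (λ i → ∑-cong L (λ j → F≗G _ _))

  squareSum-mono : {F G : ℤ → ℤ → ℕ} → (∀ x y → F x y ≤ G x y) → squareSum a L F ≤ squareSum a L G
  squareSum-mono F≤G = ∑-mono L (λ i → ∑-mono L (λ j → F≤G _ _))

  squareSum-distrib-+ : ∀ (F G : ℤ → ℤ → ℕ) →
    squareSum a L (λ x y → F x y + G x y) ≡ squareSum a L F + squareSum a L G
  squareSum-distrib-+ F G = trans (∑-cong L (λ i → ∑-distrib-+ L _ _)) (∑-distrib-+ L _ _)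

  squareSum-distribˡ-* : ∀ k (F : ℤ → ℤ → ℕ) → squareSum a L (λ x y → k * F x y) ≡ k * squareSum a L F
  squareSum-distribˡ-* k F = trans (∑-cong L (λ i → ∑-distribˡ-* L k _)) (∑-distribˡ-* L k _)

  squareSum-const : ∀ k → squareSum a L (λ _ _ → k) ≡ L * L * k
  squareSum-const k = trans (∑-cong L (λ i → ∑-const L k)) (trans (∑-const L (L * k)) (sym (*-assoc L L k)))

  squareSum-≡⇒≗ : ∀ {F G : ℤ → ℤ → ℕ} → (∀ x y → F x y ≤ G x y) → squareSum a L F ≡ squareSum a L G →
    ∀ i j → i < L → j < L → F (a ℤ.+ + i) (a ℤ.+ + j) ≡ G (a ℤ.+ + i) (a ℤ.+ + j)
  squareSum-≡⇒≗ F≤G eq i j i<L j<L =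
    ∑-≡⇒≗ L (λ j → F≤G _ _) (∑-≡⇒≗ L (λ i → ∑-mono L (λ j → F≤G _ _)) eq i i<L) j j<L

corner : ℕ → ℤ
corner m = ℤ.- (+ m)

side : ℕ → ℕ
side m = suc (m + m)

m≤side : ∀ m → m ≤ side m
m≤side m = ≤-trans (m≤m+n m m) (n≤1+n (m + m))

count≡squareSum : ∀ S m → count S m ≡ squareSum (corner m) (side m) (λ x y → bit (S x y))
count≡squareSum S m = trans (sum-coords (λ x → sum (map (λ y → bit (S x y)) (coords m))))
                            (∑-cong (side m) (λ i → sum-coords (λ y → bit (S (corner m ℤ.+ + i) y))))
  where
  sum-coords : (f : ℤ → ℕ) → sum (map f (coords m)) ≡ intervalSum (corner m) (side m) f
  sum-coords f = trans (go (side m) (λ i → i)) (∑-cong (side m) (λ i → cong f (ℤP.+-comm (+ i) (corner m))))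
    where
    go : ∀ n (h : ℕ → ℕ) → sum (map f (map (λ i → + i ℤ.- + m) (applyUpTo h n))) ≡ ∑ n (λ i → f (+ h i ℤ.- + m))
    go zero    h = refl
    go (suc n) h = cong (λ z → f (+ h 0 ℤ.- + m) + z) (go n (h ∘ suc))

corner+unit : ∀ m u → ℤ.∣ u ∣ ≤ 1 → ∃[ c ] c ≤ 2 × corner m ℤ.+ u ≡ corner (suc m) ℤ.+ + c
corner+unit m -[1+ 0 ]   _         = 0 , z≤n , -1≡ (+ m)
  where
  -1≡ : ∀ M → ℤ.- M ℤ.+ -[1+ 0 ] ≡ ℤ.- (+ 1 ℤ.+ M) ℤ.+ + 0
  -1≡ = ℤSolver.solve-∀
corner+unit m (+ 0)      _         = 1 , s≤s z≤n , 0≡ (+ m)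
  where
  0≡ : ∀ M → ℤ.- M ℤ.+ + 0 ≡ ℤ.- (+ 1 ℤ.+ M) ℤ.+ + 1
  0≡ = ℤSolver.solve-∀
corner+unit m (+ 1)      _         = 2 , s≤s (s≤s z≤n) , +1≡ (+ m)
  where
  +1≡ : ∀ M → ℤ.- M ℤ.+ + 1 ≡ ℤ.- (+ 1 ℤ.+ M) ℤ.+ + 2
  +1≡ = ℤSolver.solve-∀
corner+unit m (+ suc (suc _)) (s≤s ())
corner+unit m -[1+ suc _ ]    (s≤s ())

intervalSum-unit-shift : ∀ m u (g : ℤ → ℕ) → ℤ.∣ u ∣ ≤ 1 →
  intervalSum (corner m ℤ.+ u) (side m) g ≤ intervalSum (corner (suc m)) (side (suc m)) g
intervalSum-unit-shift m u g unit with corner+unit m u unit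
... | c , c≤2 , eq rewrite eq = intervalSum-mono-⊆ (corner (suc m)) c (side m) (side (suc m)) g
  (≤-trans (+-monoˡ-≤ (side m) c≤2) (≤-reflexive (cong (suc ∘ suc) (sym (+-suc m m)))))

squareSum-unit-shift : ∀ m (F : ℤ → ℤ → ℕ) u v → ℤ.∣ u ∣ ≤ 1 → ℤ.∣ v ∣ ≤ 1 →
  squareSum (corner m) (side m) (λ x y → F (x ℤ.+ u) (y ℤ.+ v)) ≤ squareSum (corner (suc m)) (side (suc m)) F
squareSum-unit-shift m F u v unit-u unit-v = begin
  intervalSum (corner m) (side m) (λ x → intervalSum (corner m) (side m) (λ y → F (x ℤ.+ u) (y ℤ.+ v)))
    ≡⟨ ∑-cong (side m) (λ i → intervalSum-translate (corner m) (side m) v (F (corner m ℤ.+ + i ℤ.+ u))) ⟩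
  intervalSum (corner m) (side m) (λ x → intervalSum (corner m ℤ.+ v) (side m) (F (x ℤ.+ u)))
    ≡⟨ intervalSum-translate (corner m) (side m) u (λ x → intervalSum (corner m ℤ.+ v) (side m) (F x)) ⟩
  intervalSum (corner m ℤ.+ u) (side m) (λ x → intervalSum (corner m ℤ.+ v) (side m) (F x))
    ≤⟨ ∑-mono (side m) (λ i → intervalSum-unit-shift m v (F (corner m ℤ.+ u ℤ.+ + i)) unit-v) ⟩
  intervalSum (corner m ℤ.+ u) (side m) (λ x → intervalSum (corner (suc m)) (side (suc m)) (F x))
    ≤⟨ intervalSum-unit-shift m u (λ x → intervalSum (corner (suc m)) (side (suc m)) (F x)) unit-u ⟩
  squareSum (corner (suc m)) (side (suc m)) F ∎
  where open ≤-Reasoning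

squareSum-box-mono : ∀ m F → squareSum (corner m) (side m) F ≤ squareSum (corner (suc m)) (side (suc m)) F
squareSum-box-mono m F = ≤-trans
  (≤-reflexive (squareSum-cong (corner m) (side m) (λ x y → sym (cong₂ F (ℤP.+-identityʳ x) (ℤP.+-identityʳ y)))))
  (squareSum-unit-shift m F (+ 0) (+ 0) z≤n z≤n)

-- Translation invariance

Invariant : {A : Set} → (ℤ → ℤ → A) → ℤ × ℤ → Set
Invariant F (a , b) = ∀ x y → F (x ℤ.+ a) (y ℤ.+ b) ≡ F x y

module _ {A : Set} {F : ℤ → ℤ → A} where

  Invariant-+ : ∀ {a b c d} → Invariant F (a , b) → Invariant F (c , d) → Invariant F (a ℤ.+ c , b ℤ.+ d)
  Invariant-+ {a} {b} {c} {d} inv₁ inv₂ x y =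
    trans (cong₂ F (reassoc x a c) (reassoc y b d)) (trans (inv₁ (x ℤ.+ c) (y ℤ.+ d)) (inv₂ x y))
    where
    reassoc : ∀ x a c → x ℤ.+ (a ℤ.+ c) ≡ x ℤ.+ c ℤ.+ a
    reassoc = ℤSolver.solve-∀

  Invariant-* : ∀ {a b} → Invariant F (a , b) → ∀ z → Invariant F (z ℤ.* a , z ℤ.* b)
  Invariant-* {a} {b} inv z x y = trans (shift-invariant⇒constant along step z) (cong₂ F (at-zero x a) (at-zero y b))
    where
    along : ℤ → A
    along t = F (x ℤ.+ t ℤ.* a) (y ℤ.+ t ℤ.* b)
    next : ∀ x t a → x ℤ.+ (t ℤ.+ + 1) ℤ.* a ≡ x ℤ.+ t ℤ.* a ℤ.+ a
    next = ℤSolver.solve-∀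
    at-zero : ∀ x a → x ℤ.+ + 0 ℤ.* a ≡ x
    at-zero = ℤSolver.solve-∀
    step : ∀ t → along (t ℤ.+ + 1) ≡ along t
    step t = trans (cong₂ F (next x t a) (next y t b)) (inv _ _)

  Invariant⇒periodicˣ : ∀ {a} → Invariant F (a , + 0) → ∀ x y → F (x ℤ.+ a) y ≡ F x y
  Invariant⇒periodicˣ {a} inv x y = trans (cong (F (x ℤ.+ a)) (sym (ℤP.+-identityʳ y))) (inv x y)

  Invariant⇒periodicʸ : ∀ {b} → Invariant F (+ 0 , b) → ∀ x y → F x (y ℤ.+ b) ≡ F x y
  Invariant⇒periodicʸ {b} inv x y = trans (cong (λ z → F z (y ℤ.+ b)) (sym (ℤP.+-identityʳ x))) (inv x y)

  Invariant-reduce : ∀ D .{{_ : NonZero D}} → Invariant F (+ D , + 0) → Invariant F (+ 0 , + D) →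
    ∀ x y → F x y ≡ F (+ (x %ℕ D)) (+ (y %ℕ D))
  Invariant-reduce D invˣ invʸ x y =
    trans (cong₂ F (a≡a%ℕn+[a/ℕn]*n x D) (a≡a%ℕn+[a/ℕn]*n y D)) (periods (+ (x %ℕ D)) (+ (y %ℕ D)))
    where
    drop₂ : ∀ p q d → p ℤ.* d ℤ.+ q ℤ.* + 0 ≡ p ℤ.* d
    drop₂ = ℤSolver.solve-∀
    drop₁ : ∀ p q d → p ℤ.* + 0 ℤ.+ q ℤ.* d ≡ q ℤ.* d
    drop₁ = ℤSolver.solve-∀
    periods : Invariant F (x /ℕ D ℤ.* + D , y /ℕ D ℤ.* + D)
    periods = subst₂ (λ a b → Invariant F (a , b)) (drop₂ (x /ℕ D) (y /ℕ D) (+ D)) (drop₁ (x /ℕ D) (y /ℕ D) (+ D))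
                     (Invariant-+ (Invariant-* invˣ (x /ℕ D)) (Invariant-* invʸ (y /ℕ D)))

  Invariant-neg : ∀ {a b} → Invariant F (a , b) → Invariant F (ℤ.- a , ℤ.- b)
  Invariant-neg {a} {b} inv = subst₂ (λ a b → Invariant F (a , b)) (neg a) (neg b) (Invariant-* inv (ℤ.- + 1))
    where
    neg : ∀ a → ℤ.- + 1 ℤ.* a ≡ ℤ.- a
    neg = ℤSolver.solve-∀

  square-period : ∀ {δ} → δ ≢ + 0 → Invariant F (δ , + 0) → Invariant F (+ 0 , δ) →
    ∃[ d ] Invariant F (+ suc d , + 0) × Invariant F (+ 0 , + suc d)
  square-period {δ = + zero}   δ≢0 _    _    = ⊥-elim (δ≢0 refl)
  square-period {δ = + suc d}  _   invˣ invʸ = d , invˣ , invʸ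
  square-period {δ = -[1+ d ]} _   invˣ invʸ = d , Invariant-neg invˣ , Invariant-neg invʸ

Invariant-translate : ∀ {A : Set} {F : ℤ → ℤ → A} {a b} → Invariant F (a , b) →
  ∀ u w → Invariant (λ x y → F (x ℤ.+ u) (y ℤ.+ w)) (a , b)
Invariant-translate {F = F} {a} {b} inv u w x y = trans (cong₂ F (swap x a u) (swap y b w)) (inv _ _)
  where
  swap : ∀ x a u → x ℤ.+ a ℤ.+ u ≡ x ℤ.+ u ℤ.+ a
  swap = ℤSolver.solve-∀

Invariant-zip : ∀ {A B C : Set} {F : ℤ → ℤ → A} {G : ℤ → ℤ → B} (h : A → B → C) {v} →
  Invariant F v → Invariant G v → Invariant (λ x y → h (F x y) (G x y)) v
Invariant-zip h {a , b} invF invG x y = cong₂ h (invF x y) (invG x y)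

Invariant-map : ∀ {A B : Set} {F : ℤ → ℤ → A} (h : A → B) {v} → Invariant F v → Invariant (λ x y → h (F x y)) v
Invariant-map h {a , b} inv x y = cong h (inv x y)

≗-from-fundamental-square : ∀ {A : Set} {F G : ℤ → ℤ → A} D .{{_ : NonZero D}} →
  Invariant F (+ D , + 0) → Invariant F (+ 0 , + D) → Invariant G (+ D , + 0) → Invariant G (+ 0 , + D) →
  (∀ i j → i < D → j < D → F (+ i) (+ j) ≡ G (+ i) (+ j)) → ∀ x y → F x y ≡ G x y
≗-from-fundamental-square D Fˣ Fʸ Gˣ Gʸ agree x y =
  trans (Invariant-reduce D Fˣ Fʸ x y)
        (trans (agree _ _ (n%ℕd<d x D) (n%ℕd<d y D)) (sym (Invariant-reduce D Gˣ Gʸ x y)))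

-- The determinant δ = ad − bc is a common period: δ e₁ = d (a , b) − b (c , d) and
-- δ e₂ = a (c , d) − c (a , b).
periodic⇒square-period : ∀ S → Periodic S → ∃[ d ] Invariant S (+ suc d , + 0) × Invariant S (+ 0 , + suc d)
periodic⇒square-period S (a , b , c , d , det≢0 , inv₁ , inv₂) = square-period det≢0
  (subst₂ (λ u v → Invariant S (u , v)) (e₁ a b c d) (e₂ b d)
          (Invariant-+ (Invariant-* inv₁ d) (Invariant-* inv₂ (ℤ.- b))))
  (subst₂ (λ u v → Invariant S (u , v)) (e₂ c a) (e₃ a b c d)
          (Invariant-+ (Invariant-* inv₂ a) (Invariant-* inv₁ (ℤ.- c))))
  where
  e₁ : ∀ a b c d → d ℤ.* a ℤ.+ ℤ.- b ℤ.* c ≡ a ℤ.* d ℤ.- b ℤ.* c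
  e₁ = ℤSolver.solve-∀
  e₂ : ∀ b d → d ℤ.* b ℤ.+ ℤ.- b ℤ.* d ≡ + 0
  e₂ = ℤSolver.solve-∀
  e₃ : ∀ a b c d → a ℤ.* d ℤ.+ ℤ.- c ℤ.* b ≡ a ℤ.* d ℤ.- b ℤ.* c
  e₃ = ℤSolver.solve-∀

intervalSum-rows-periodic : ∀ D (F : ℤ → ℤ → ℕ) → Invariant F (+ D , + 0) →
  ∀ a L x → intervalSum a L (F (x ℤ.+ + D)) ≡ intervalSum a L (F x)
intervalSum-rows-periodic D F inv a L x = ∑-cong L (λ j → Invariant⇒periodicˣ inv x _)

module _ (D : ℕ) (F : ℤ → ℤ → ℕ) (invˣ : Invariant F (+ D , + 0)) (invʸ : Invariant F (+ 0 , + D)) where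

  squareSum-invariant-shift : ∀ u v → squareSum (+ 0) D (λ x y → F (x ℤ.+ u) (y ℤ.+ v)) ≡ squareSum (+ 0) D F
  squareSum-invariant-shift u v = begin
    intervalSum (+ 0) D (λ x → intervalSum (+ 0) D (λ y → F (x ℤ.+ u) (y ℤ.+ v)))
      ≡⟨ ∑-cong D (λ i → intervalSum-translate (+ 0) D v (F (+ i ℤ.+ u))) ⟩
    intervalSum (+ 0) D (λ x → intervalSum (+ 0 ℤ.+ v) D (F (x ℤ.+ u)))
      ≡⟨ ∑-cong D (λ i → intervalSum-periodic D (F (+ i ℤ.+ u)) (Invariant⇒periodicʸ invʸ (+ i ℤ.+ u)) (+ 0 ℤ.+ v)) ⟩
    intervalSum (+ 0) D (λ x → row (x ℤ.+ u))
      ≡⟨ intervalSum-translate (+ 0) D u row ⟩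
    intervalSum (+ 0 ℤ.+ u) D row
      ≡⟨ intervalSum-periodic D row (intervalSum-rows-periodic D F invˣ (+ 0) D) (+ 0 ℤ.+ u) ⟩
    squareSum (+ 0) D F ∎
    where
    open ≡-Reasoning
    row : ℤ → ℕ
    row x = intervalSum (+ 0) D (F x)

-- Double counting of neighbouring pairs

sumOver : List (ℤ × ℤ) → (ℤ → ℤ → ℕ) → ℕ
sumOver []             f = 0
sumOver ((u , v) ∷ os) f = f u v + sumOver os f

sumOver-cong : ∀ os {f g : ℤ → ℤ → ℕ} → (∀ u v → f u v ≡ g u v) → sumOver os f ≡ sumOver os g
sumOver-cong []             f≗g = refl
sumOver-cong ((u , v) ∷ os) f≗g = cong₂ _+_ (f≗g u v) (sumOver-cong os f≗g)

sumOver-mono : ∀ {P : ℤ × ℤ → Set} {os} {f g : ℤ → ℤ → ℕ} → All P os →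
  (∀ {u v} → P (u , v) → f u v ≤ g u v) → sumOver os f ≤ sumOver os g
sumOver-mono                          []       f≤g = z≤n
sumOver-mono {os = (u , v) ∷ os} (p ∷ ps) f≤g = +-mono-≤ (f≤g p) (sumOver-mono ps f≤g)

sumOver-distrib-+ : ∀ os (f g : ℤ → ℤ → ℕ) → sumOver os (λ u v → f u v + g u v) ≡ sumOver os f + sumOver os g
sumOver-distrib-+ []             f g = refl
sumOver-distrib-+ ((u , v) ∷ os) f g =
  trans (cong (λ z → f u v + g u v + z) (sumOver-distrib-+ os f g)) (+-interchange (f u v) (g u v) _ _)
  where
  +-interchange : ∀ a b c d → a + b + (c + d) ≡ a + c + (b + d)
  +-interchange = solve-∀

sumOver-distribˡ-* : ∀ os k (f : ℤ → ℤ → ℕ) → sumOver os (λ u v → k * f u v) ≡ k * sumOver os f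
sumOver-distribˡ-* []             k f = sym (*-zeroʳ k)
sumOver-distribˡ-* ((u , v) ∷ os) k f =
  trans (cong (λ z → k * f u v + z) (sumOver-distribˡ-* os k f)) (sym (*-distribˡ-+ k (f u v) _))

sumOver-const : ∀ os k → sumOver os (λ _ _ → k) ≡ length os * k
sumOver-const []             k = refl
sumOver-const ((u , v) ∷ os) k = cong (λ z → k + z) (sumOver-const os k)

∑-sumOver-comm : ∀ n os (F : ℕ → ℤ → ℤ → ℕ) →
  ∑ n (λ i → sumOver os (F i)) ≡ sumOver os (λ u v → ∑ n (λ i → F i u v))
∑-sumOver-comm n []             F = trans (∑-const n 0) (*-zeroʳ n)
∑-sumOver-comm n ((u , v) ∷ os) F =
  trans (∑-distrib-+ n _ _) (cong (λ z → ∑ n (λ i → F i u v) + z) (∑-sumOver-comm n os F))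

squareSum-sumOver-comm : ∀ a L os (F : ℤ → ℤ → ℤ → ℤ → ℕ) →
  squareSum a L (λ x y → sumOver os (F x y)) ≡ sumOver os (λ u v → squareSum a L (λ x y → F x y u v))
squareSum-sumOver-comm a L os F =
  trans (∑-cong L (λ i → ∑-sumOver-comm L os _)) (∑-sumOver-comm L os _)

Adjacent : ℤ × ℤ → Set
Adjacent (u , v) = ℤ.∣ u ∣ ≤ 1 × ℤ.∣ v ∣ ≤ 1

offsets-adjacent : All Adjacent offsets
offsets-adjacent = (1≤1 , 1≤1) ∷ (1≤1 , z≤n) ∷ (1≤1 , 1≤1) ∷ (z≤n , 1≤1) ∷ (z≤n , 1≤1)
                 ∷ (1≤1 , 1≤1) ∷ (1≤1 , z≤n) ∷ (1≤1 , 1≤1) ∷ []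
  where
  1≤1 : 1 ≤ 1
  1≤1 = s≤s z≤n

-- Negating every offset reverses the list offsets.
offsets-symmetric : ∀ (K : ℤ → ℤ → ℕ) → sumOver offsets (λ u v → K (ℤ.- u) (ℤ.- v)) ≡ sumOver offsets K
offsets-symmetric K = reverse (K (+ 1) (+ 1)) (K (+ 1) (+ 0)) (K (+ 1) -[1+ 0 ]) (K (+ 0) (+ 1))
                              (K (+ 0) -[1+ 0 ]) (K -[1+ 0 ] (+ 1)) (K -[1+ 0 ] (+ 0)) (K -[1+ 0 ] -[1+ 0 ])
  where
  reverse : ∀ a₁ a₂ a₃ a₄ a₅ a₆ a₇ a₈ →
    a₁ + (a₂ + (a₃ + (a₄ + (a₅ + (a₆ + (a₇ + (a₈ + 0))))))) ≡
    a₈ + (a₇ + (a₆ + (a₅ + (a₄ + (a₃ + (a₂ + (a₁ + 0)))))))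
  reverse = solve-∀

nbrSum : (ℤ → ℤ → ℕ) → ℤ → ℤ → ℕ
nbrSum g x y = sumOver offsets (λ u v → g (x ℤ.+ u) (y ℤ.+ v))

Invariant-nbrSum : ∀ {g : ℤ → ℤ → ℕ} {v} → Invariant g v → Invariant (nbrSum g) v
Invariant-nbrSum {v = a , b} inv x y = sumOver-cong offsets (λ u w → Invariant-translate inv u w x y)

module _ (f g : ℤ → ℤ → ℕ) where

  -- A pair of neighbours (x , x + o) is counted once from x and once from y = x + o.
  private
    pullback : ℤ → ℤ → ℤ → ℤ → ℕ
    pullback u v x y = f (x ℤ.- u) (y ℤ.- v) * g x y

    outflow : ∀ a L → squareSum a L (λ x y → f x y * nbrSum g x y) ≡
      sumOver offsets (λ u v → squareSum a L (λ x y → pullback u v (x ℤ.+ u) (y ℤ.+ v)))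
    outflow a L = begin
      squareSum a L (λ x y → f x y * nbrSum g x y)
        ≡⟨ squareSum-cong a L (λ x y → sym (sumOver-distribˡ-* offsets (f x y) (λ u v → g (x ℤ.+ u) (y ℤ.+ v)))) ⟩
      squareSum a L (λ x y → sumOver offsets (λ u v → f x y * g (x ℤ.+ u) (y ℤ.+ v)))
        ≡⟨ squareSum-sumOver-comm a L offsets (λ x y u v → f x y * g (x ℤ.+ u) (y ℤ.+ v)) ⟩
      sumOver offsets (λ u v → squareSum a L (λ x y → f x y * g (x ℤ.+ u) (y ℤ.+ v)))
        ≡⟨ sumOver-cong offsets (λ u v → squareSum-cong a L (λ x y →
             cong (λ z → z * g (x ℤ.+ u) (y ℤ.+ v)) (cong₂ f (cancel x u) (cancel y v)))) ⟩
      sumOver offsets (λ u v → squareSum a L (λ x y → pullback u v (x ℤ.+ u) (y ℤ.+ v))) ∎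
      where
      open ≡-Reasoning
      cancel : ∀ x u → x ≡ x ℤ.+ u ℤ.- u
      cancel = ℤSolver.solve-∀

    inflow : ∀ a L → squareSum a L (λ x y → g x y * nbrSum f x y) ≡
      sumOver offsets (λ u v → squareSum a L (pullback u v))
    inflow a L = begin
      squareSum a L (λ x y → g x y * nbrSum f x y)
        ≡⟨ squareSum-cong a L (λ x y → sym (sumOver-distribˡ-* offsets (g x y) (λ u v → f (x ℤ.+ u) (y ℤ.+ v)))) ⟩
      squareSum a L (λ x y → sumOver offsets (λ u v → g x y * f (x ℤ.+ u) (y ℤ.+ v)))
        ≡⟨ squareSum-sumOver-comm a L offsets (λ x y u v → g x y * f (x ℤ.+ u) (y ℤ.+ v)) ⟩
      sumOver offsets (λ u v → squareSum a L (λ x y → g x y * f (x ℤ.+ u) (y ℤ.+ v)))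
        ≡⟨ sumOver-cong offsets (λ u v → squareSum-cong a L (λ x y → *-comm (g x y) (f (x ℤ.+ u) (y ℤ.+ v)))) ⟩
      sumOver offsets (λ u v → squareSum a L (λ x y → f (x ℤ.+ u) (y ℤ.+ v) * g x y))
        ≡⟨ offsets-symmetric (λ u v → squareSum a L (λ x y → f (x ℤ.+ u) (y ℤ.+ v) * g x y)) ⟨
      sumOver offsets (λ u v → squareSum a L (pullback u v)) ∎
      where open ≡-Reasoning

  double-counting-box : ∀ m →
    squareSum (corner m) (side m) (λ x y → f x y * nbrSum g x y) ≤
    squareSum (corner (suc m)) (side (suc m)) (λ x y → g x y * nbrSum f x y)
  double-counting-box m = begin
    squareSum (corner m) (side m) (λ x y → f x y * nbrSum g x y)
      ≡⟨ outflow (corner m) (side m) ⟩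
    sumOver offsets (λ u v → squareSum (corner m) (side m) (λ x y → pullback u v (x ℤ.+ u) (y ℤ.+ v)))
      ≤⟨ sumOver-mono offsets-adjacent (λ { {u} {v} (∣u∣≤1 , ∣v∣≤1) →
           squareSum-unit-shift m (pullback u v) u v ∣u∣≤1 ∣v∣≤1 }) ⟩
    sumOver offsets (λ u v → squareSum (corner (suc m)) (side (suc m)) (pullback u v))
      ≡⟨ inflow (corner (suc m)) (side (suc m)) ⟨
    squareSum (corner (suc m)) (side (suc m)) (λ x y → g x y * nbrSum f x y) ∎
    where open ≤-Reasoning

  double-counting-torus : ∀ D → Invariant f (+ D , + 0) → Invariant f (+ 0 , + D) →
    Invariant g (+ D , + 0) → Invariant g (+ 0 , + D) →
    squareSum (+ 0) D (λ x y → f x y * nbrSum g x y) ≡ squareSum (+ 0) D (λ x y → g x y * nbrSum f x y)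
  double-counting-torus D fˣ fʸ gˣ gʸ = begin
    squareSum (+ 0) D (λ x y → f x y * nbrSum g x y)
      ≡⟨ outflow (+ 0) D ⟩
    sumOver offsets (λ u v → squareSum (+ 0) D (λ x y → pullback u v (x ℤ.+ u) (y ℤ.+ v)))
      ≡⟨ sumOver-cong offsets (λ u v → squareSum-invariant-shift D (pullback u v)
           (Invariant-zip _*_ (Invariant-translate fˣ _ _) gˣ) (Invariant-zip _*_ (Invariant-translate fʸ _ _) gʸ) u v) ⟩
    sumOver offsets (λ u v → squareSum (+ 0) D (pullback u v))
      ≡⟨ inflow (+ 0) D ⟨
    squareSum (+ 0) D (λ x y → g x y * nbrSum f x y) ∎
    where open ≡-Reasoning

∁ : SubsetZ² → SubsetZ²
∁ S x y = not (S x y)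

χ : SubsetZ² → ℤ → ℤ → ℕ
χ S x y = bit (S x y)

χ≤1 : ∀ S x y → χ S x y ≤ 1
χ≤1 S x y with S x y
... | true  = ≤-refl
... | false = z≤n

χ+χ∁≡1 : ∀ S x y → χ S x y + χ (∁ S) x y ≡ 1
χ+χ∁≡1 S x y with S x y
... | true  = refl
... | false = refl

N+N∁≡8 : ∀ S x y → N S x y + N (∁ S) x y ≡ 8
N+N∁≡8 S x y = begin
  nbrSum (χ S) x y + nbrSum (χ (∁ S)) x y     ≡⟨ sumOver-distrib-+ offsets (neighbour (χ S)) (neighbour (χ (∁ S))) ⟨
  sumOver offsets (λ u v → neighbour (χ S) u v + neighbour (χ (∁ S)) u v)
                                              ≡⟨ sumOver-cong offsets (λ u v → χ+χ∁≡1 S (x ℤ.+ u) (y ℤ.+ v)) ⟩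
  sumOver offsets (λ _ _ → 1)                 ≡⟨ sumOver-const offsets 1 ⟩
  8                                           ∎
  where
  open ≡-Reasoning
  neighbour : (ℤ → ℤ → ℕ) → ℤ → ℤ → ℕ
  neighbour g u v = g (x ℤ.+ u) (y ℤ.+ v)

N∁≡8∸N : ∀ S x y → N (∁ S) x y ≡ 8 ∸ N S x y
N∁≡8∸N S x y = trans (sym (m+n∸m≡n (N S x y) _)) (cong (_∸ N S x y) (N+N∁≡8 S x y))

N≤8 : ∀ S x y → N S x y ≤ 8
N≤8 S x y = ≤-trans (m≤m+n _ _) (≤-reflexive (N+N∁≡8 S x y))

-- χ S · N (∁ S) counts the pairs starting at a point of S, χ (∁ S) · N S those ending at a
-- point outside S.
module _ (S : SubsetZ²) (n : ℕ) where

  boundary-lower : (∀ x y → S x y ≡ true → N S x y ≤ n) →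
    ∀ x y → (8 ∸ n) * χ S x y ≤ χ S x y * N (∁ S) x y
  boundary-lower sparse x y with S x y in eq
  ... | false = ≤-trans (≤-reflexive (*-zeroʳ (8 ∸ n))) z≤n
  ... | true  = begin
    (8 ∸ n) * 1       ≡⟨ *-identityʳ _ ⟩
    8 ∸ n             ≤⟨ ∸-monoʳ-≤ 8 (sparse x y eq) ⟩
    8 ∸ N S x y       ≡⟨ N∁≡8∸N S x y ⟨
    N (∁ S) x y       ≡⟨ *-identityˡ _ ⟨
    1 * N (∁ S) x y   ∎
    where open ≤-Reasoning

  boundary-lower-≡⇔ : n ≤ 8 →
    (∀ x y → (8 ∸ n) * χ S x y ≡ χ S x y * N (∁ S) x y) ⇔ (∀ x y → S x y ≡ true → N S x y ≡ n)
  boundary-lower-≡⇔ n≤8 = mk⇔ to from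
    where
    open ≡-Reasoning
    to : (∀ x y → (8 ∸ n) * χ S x y ≡ χ S x y * N (∁ S) x y) → ∀ x y → S x y ≡ true → N S x y ≡ n
    to tight x y eq = sym (∸-cancelˡ-≡ n≤8 (N≤8 S x y) (begin
      8 ∸ n             ≡⟨ *-identityʳ (8 ∸ n) ⟨
      (8 ∸ n) * 1       ≡⟨ subst (λ b → (8 ∸ n) * bit b ≡ bit b * N (∁ S) x y) eq (tight x y) ⟩
      1 * N (∁ S) x y   ≡⟨ *-identityˡ _ ⟩
      N (∁ S) x y       ≡⟨ N∁≡8∸N S x y ⟩
      8 ∸ N S x y       ∎))
    from : (∀ x y → S x y ≡ true → N S x y ≡ n) → ∀ x y → (8 ∸ n) * χ S x y ≡ χ S x y * N (∁ S) x y
    from extremal x y with S x y in eq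
    ... | false = *-zeroʳ (8 ∸ n)
    ... | true  = begin
      (8 ∸ n) * 1       ≡⟨ *-identityʳ (8 ∸ n) ⟩
      8 ∸ n             ≡⟨ cong (8 ∸_) (extremal x y eq) ⟨
      8 ∸ N S x y       ≡⟨ N∁≡8∸N S x y ⟨
      N (∁ S) x y       ≡⟨ *-identityˡ _ ⟨
      1 * N (∁ S) x y   ∎

boundary-upper : ∀ S x y → χ (∁ S) x y * N S x y ≤ 8 * χ (∁ S) x y
boundary-upper S x y = ≤-trans (*-monoʳ-≤ (χ (∁ S) x y) (N≤8 S x y)) (≤-reflexive (*-comm (χ (∁ S) x y) 8))

boundary-upper-≡⇔ : ∀ S →
  (∀ x y → χ (∁ S) x y * N S x y ≡ 8 * χ (∁ S) x y) ⇔ (∀ x y → S x y ≡ false → N S x y ≡ 8)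
boundary-upper-≡⇔ S = mk⇔ to from
  where
  to : (∀ x y → χ (∁ S) x y * N S x y ≡ 8 * χ (∁ S) x y) → ∀ x y → S x y ≡ false → N S x y ≡ 8
  to tight x y eq = trans (sym (*-identityˡ _)) (subst (λ b → bit (not b) * N S x y ≡ 8 * bit (not b)) eq (tight x y))
  from : (∀ x y → S x y ≡ false → N S x y ≡ 8) → ∀ x y → χ (∁ S) x y * N S x y ≡ 8 * χ (∁ S) x y
  from extremal x y with S x y in eq
  ... | true  = refl
  ... | false = trans (*-identityˡ _) (extremal x y eq)

-- Density arithmetic

near-square : ∀ X D L → X ≤ L → L ≤ X + D → L * L ≤ X * X + 2 * (D * L)
near-square X D L X≤L L≤X+D = begin
  L * L                       ≤⟨ *-monoˡ-≤ L L≤X+D ⟩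
  (X + D) * L                 ≡⟨ *-distribʳ-+ L X D ⟩
  X * L + D * L               ≤⟨ +-monoˡ-≤ (D * L) (*-monoʳ-≤ X L≤X+D) ⟩
  X * (X + D) + D * L         ≡⟨ expand X D L ⟩
  X * X + D * X + D * L       ≤⟨ +-monoˡ-≤ (D * L) (+-monoʳ-≤ (X * X) (*-monoʳ-≤ D X≤L)) ⟩
  X * X + D * L + D * L       ≡⟨ collect (X * X) (D * L) ⟩
  X * X + 2 * (D * L)         ∎
  where
  open ≤-Reasoning
  expand : ∀ X D L → X * (X + D) + D * L ≡ X * X + D * X + D * L
  expand = solve-∀
  collect : ∀ A B → A + B + B ≡ A + 2 * B
  collect = solve-∀

module _ (s D L q : ℕ) (qD≤L : q * D ≤ L) where

  periodic-count-upper : ∀ {x} → x ≤ q * (q * s + D * D) + L * D →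
    x * (D * D) ≤ s * (L * L) + L * (2 * (D * (D * D)))
  periodic-count-upper {x} x≤ = begin
    x * (D * D)                                                          ≤⟨ *-monoˡ-≤ (D * D) x≤ ⟩
    (q * (q * s + D * D) + L * D) * (D * D)                              ≡⟨ expand q s D L ⟩
    s * (q * D * (q * D)) + q * D * (D * (D * D)) + L * (D * (D * D))    ≤⟨ +-monoˡ-≤ _ (+-mono-≤ (*-monoʳ-≤ s (*-mono-≤ qD≤L qD≤L))
                                                                                                    (*-monoˡ-≤ _ qD≤L)) ⟩
    s * (L * L) + L * (D * (D * D)) + L * (D * (D * D))                  ≡⟨ collect (s * (L * L)) L (D * (D * D)) ⟩
    s * (L * L) + L * (2 * (D * (D * D)))                                ∎
    where
    open ≤-Reasoning
    expand : ∀ q s D L → (q * (q * s + D * D) + L * D) * (D * D) ≡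
                         s * (q * D * (q * D)) + q * D * (D * (D * D)) + L * (D * (D * D))
    expand = solve-∀
    collect : ∀ A L E → A + L * E + L * E ≡ A + L * (2 * E)
    collect = solve-∀

  periodic-count-lower : ∀ {x} → s ≤ D * D → L ≤ q * D + D → q * (q * s) ≤ x →
    s * (L * L) ≤ x * (D * D) + L * (2 * (D * (D * D)))
  periodic-count-lower {x} s≤DD L≤ x≥ = begin
    s * (L * L)                                       ≤⟨ *-monoʳ-≤ s (near-square (q * D) D L qD≤L L≤) ⟩
    s * (q * D * (q * D) + 2 * (D * L))               ≡⟨ expand s q D L ⟩
    q * (q * s) * (D * D) + 2 * (s * (D * L))         ≤⟨ +-mono-≤ (*-monoˡ-≤ (D * D) x≥) (*-monoʳ-≤ 2 (*-monoˡ-≤ (D * L) s≤DD)) ⟩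
    x * (D * D) + 2 * (D * D * (D * L))               ≡⟨ cong (λ z → x * (D * D) + z) (rearrange D L) ⟩
    x * (D * D) + L * (2 * (D * (D * D)))             ∎
    where
    open ≤-Reasoning
    expand : ∀ s q D L → s * (q * D * (q * D) + 2 * (D * L)) ≡ q * (q * s) * (D * D) + 2 * (s * (D * L))
    expand = solve-∀
    rearrange : ∀ D L → 2 * (D * D * (D * L)) ≡ L * (2 * (D * (D * D)))
    rearrange = solve-∀

+-suc-* : ∀ a b → a * b + a ≡ a * suc b
+-suc-* a b = trans (+-comm (a * b) a) (sym (*-suc a b))

module _ {p q x s Δ t e : ℕ} (K : ℕ) (above : x * Δ ≤ s * t + e) (below : s * t ≤ x * Δ + e) where

  open ≤-Reasoning

  density-from-ratio : .{{_ : NonZero Δ}} → q * s ≡ p * Δ → K * e ≤ t * Δ →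
    K * q * x ≤ K * p * t + q * t × K * p * t ≤ K * q * x + q * t
  density-from-ratio qs≡pΔ Ke≤tΔ = *-cancelʳ-≤ _ _ Δ upper , *-cancelʳ-≤ _ _ Δ lower
    where
    upper : K * q * x * Δ ≤ (K * p * t + q * t) * Δ
    upper = begin
      K * q * x * Δ                  ≡⟨ *-assoc (K * q) x Δ ⟩
      K * q * (x * Δ)                ≤⟨ *-monoʳ-≤ (K * q) above ⟩
      K * q * (s * t + e)            ≡⟨ expand K q s t e ⟩
      K * t * (q * s) + q * (K * e)  ≡⟨ cong (λ z → K * t * z + q * (K * e)) qs≡pΔ ⟩
      K * t * (p * Δ) + q * (K * e)  ≤⟨ +-monoʳ-≤ (K * t * (p * Δ)) (*-monoʳ-≤ q Ke≤tΔ) ⟩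
      K * t * (p * Δ) + q * (t * Δ)  ≡⟨ collect K t p Δ q ⟩
      (K * p * t + q * t) * Δ        ∎
      where
      expand : ∀ K q s t e → K * q * (s * t + e) ≡ K * t * (q * s) + q * (K * e)
      expand = solve-∀
      collect : ∀ K t p Δ q → K * t * (p * Δ) + q * (t * Δ) ≡ (K * p * t + q * t) * Δ
      collect = solve-∀
    lower : K * p * t * Δ ≤ (K * q * x + q * t) * Δ
    lower = begin
      K * p * t * Δ                ≡⟨ reorder K p t Δ ⟩
      K * t * (p * Δ)              ≡⟨ cong (λ z → K * t * z) qs≡pΔ ⟨
      K * t * (q * s)              ≡⟨ regroup K t q s ⟩
      K * q * (s * t)              ≤⟨ *-monoʳ-≤ (K * q) below ⟩
      K * q * (x * Δ + e)          ≡⟨ expand K q x Δ e ⟩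
      K * q * x * Δ + q * (K * e)  ≤⟨ +-monoʳ-≤ (K * q * x * Δ) (*-monoʳ-≤ q Ke≤tΔ) ⟩
      K * q * x * Δ + q * (t * Δ)  ≡⟨ collect K q x Δ t ⟩
      (K * q * x + q * t) * Δ      ∎
      where
      reorder : ∀ K p t Δ → K * p * t * Δ ≡ K * t * (p * Δ)
      reorder = solve-∀
      regroup : ∀ K t q s → K * t * (q * s) ≡ K * q * (s * t)
      regroup = solve-∀
      expand : ∀ K q x Δ e → K * q * (x * Δ + e) ≡ K * q * x * Δ + q * (K * e)
      expand = solve-∀
      collect : ∀ K q x Δ t → K * q * x * Δ + q * (t * Δ) ≡ (K * q * x + q * t) * Δ
      collect = solve-∀

  density-gap-below : q * s < p * Δ → K * p * t ≤ K * q * x + q * t → K * t ≤ q * Δ * t + K * q * e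
  density-gap-below qs<pΔ lower = +-cancelˡ-≤ (K * t * (q * s)) _ _ (begin
    K * t * (q * s) + K * t         ≡⟨ +-suc-* (K * t) (q * s) ⟩
    K * t * suc (q * s)             ≤⟨ *-monoʳ-≤ (K * t) qs<pΔ ⟩
    K * t * (p * Δ)                 ≡⟨ reorder K t p Δ ⟩
    K * p * t * Δ                   ≤⟨ *-monoˡ-≤ Δ lower ⟩
    (K * q * x + q * t) * Δ         ≡⟨ expand K q x t Δ ⟩
    K * q * (x * Δ) + q * Δ * t     ≤⟨ +-monoˡ-≤ (q * Δ * t) (*-monoʳ-≤ (K * q) above) ⟩
    K * q * (s * t + e) + q * Δ * t ≡⟨ collect K q s t e Δ ⟩
    K * t * (q * s) + (q * Δ * t + K * q * e) ∎)
    where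
    reorder : ∀ K t p Δ → K * t * (p * Δ) ≡ K * p * t * Δ
    reorder = solve-∀
    expand : ∀ K q x t Δ → (K * q * x + q * t) * Δ ≡ K * q * (x * Δ) + q * Δ * t
    expand = solve-∀
    collect : ∀ K q s t e Δ → K * q * (s * t + e) + q * Δ * t ≡ K * t * (q * s) + (q * Δ * t + K * q * e)
    collect = solve-∀

  density-gap-above : p * Δ < q * s → K * q * x ≤ K * p * t + q * t → K * t ≤ q * Δ * t + K * q * e
  density-gap-above pΔ<qs upper = +-cancelˡ-≤ (K * t * (p * Δ)) _ _ (begin
    K * t * (p * Δ) + K * t             ≡⟨ +-suc-* (K * t) (p * Δ) ⟩
    K * t * suc (p * Δ)                 ≤⟨ *-monoʳ-≤ (K * t) pΔ<qs ⟩
    K * t * (q * s)                     ≡⟨ reorder K t q s ⟩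
    K * q * (s * t)                     ≤⟨ *-monoʳ-≤ (K * q) below ⟩
    K * q * (x * Δ + e)                 ≡⟨ expand K q x Δ e ⟩
    K * q * x * Δ + K * q * e           ≤⟨ +-monoˡ-≤ (K * q * e) (*-monoˡ-≤ Δ upper) ⟩
    (K * p * t + q * t) * Δ + K * q * e ≡⟨ collect K p t q Δ e ⟩
    K * t * (p * Δ) + (q * Δ * t + K * q * e) ∎)
    where
    reorder : ∀ K t q s → K * t * (q * s) ≡ K * q * (s * t)
    reorder = solve-∀
    expand : ∀ K q x Δ e → K * q * (x * Δ + e) ≡ K * q * x * Δ + K * q * e
    expand = solve-∀
    collect : ∀ K p t q Δ e → (K * p * t + q * t) * Δ + K * q * e ≡ K * t * (p * Δ) + (q * Δ * t + K * q * e)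
    collect = solve-∀

  ratio-from-density : q * s ≢ p * Δ → K * q * x ≤ K * p * t + q * t → K * p * t ≤ K * q * x + q * t →
    K * t ≤ q * Δ * t + K * q * e
  ratio-from-density qs≢pΔ upper lower with <-cmp (q * s) (p * Δ)
  ... | tri< qs<pΔ _ _ = density-gap-below qs<pΔ lower
  ... | tri≈ _ qs≡pΔ _ = contradiction qs≡pΔ qs≢pΔ
  ... | tri> _ _ pΔ<qs = density-gap-above pΔ<qs upper

upper-density-from-bound : ∀ {p q x L} k → p ≤ q → 8 * suc k ≤ L → q * x ≤ p * ((2 + L) * (2 + L)) →
  suc k * q * x ≤ suc k * p * (L * L) + q * (L * L)
upper-density-from-bound {p} {q} {x} {L} k p≤q 8K≤L qx≤ = begin
  K * q * x                                  ≡⟨ *-assoc K q x ⟩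
  K * (q * x)                                ≤⟨ *-monoʳ-≤ K qx≤ ⟩
  K * (p * ((2 + L) * (2 + L)))              ≡⟨ expand K p L ⟩
  K * p * (L * L) + p * (K * (4 * L + 4))    ≤⟨ +-monoʳ-≤ (K * p * (L * L)) (*-monoʳ-≤ p (*-monoʳ-≤ K
                                                  (+-monoʳ-≤ (4 * L) (*-monoʳ-≤ 4 1≤L)))) ⟩
  K * p * (L * L) + p * (K * (4 * L + 4 * L)) ≡⟨ cong (λ z → K * p * (L * L) + p * z) (regroup K L) ⟩
  K * p * (L * L) + p * (L * (8 * K))        ≤⟨ +-monoʳ-≤ (K * p * (L * L)) (*-monoʳ-≤ p (*-monoʳ-≤ L 8K≤L)) ⟩
  K * p * (L * L) + p * (L * L)              ≤⟨ +-monoʳ-≤ (K * p * (L * L)) (*-monoˡ-≤ (L * L) p≤q) ⟩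
  K * p * (L * L) + q * (L * L)              ∎
  where
  open ≤-Reasoning
  K = suc k
  1≤L : 1 ≤ L
  1≤L = ≤-trans (s≤s z≤n) 8K≤L
  expand : ∀ K p L → K * (p * ((2 + L) * (2 + L))) ≡ K * p * (L * L) + p * (K * (4 * L + 4))
  expand = solve-∀
  regroup : ∀ K L → K * (4 * L + 4 * L) ≡ L * (8 * K)
  regroup = solve-∀

≤-from-square-bound : ∀ c L B → suc c * (L * L) ≤ c * (L * L) + L * B → L ≤ B
≤-from-square-bound c zero      B _ = z≤n
≤-from-square-bound c L@(suc _) B h = *-cancelˡ-≤ L (+-cancelˡ-≤ (c * (L * L)) _ _
  (≤-trans (≤-reflexive (+-comm (c * (L * L)) (L * L))) h))

-- Sparse sets

module _ (S : SubsetZ²) (n : ℕ) (n≤8 : n ≤ 8) (sparse : ∀ x y → S x y ≡ true → N S x y ≤ n) where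

  sparse-count-bound : ∀ m → (16 ∸ n) * count S m ≤ 8 * ((2 + side m) * (2 + side m))
  sparse-count-bound m = begin
    (16 ∸ n) * count S m            ≡⟨ cong₂ _*_ (+-∸-comm 8 n≤8) (count≡squareSum S m) ⟩
    (8 ∸ n + 8) * inner (χ S)       ≡⟨ *-distribʳ-+ (inner (χ S)) (8 ∸ n) 8 ⟩
    (8 ∸ n) * inner (χ S) + 8 * inner (χ S)
                                    ≤⟨ +-mono-≤ boundary (*-monoʳ-≤ 8 (squareSum-box-mono m (χ S))) ⟩
    8 * outer (χ (∁ S)) + 8 * outer (χ S) ≡⟨ *-distribˡ-+ 8 (outer (χ (∁ S))) (outer (χ S)) ⟨
    8 * (outer (χ (∁ S)) + outer (χ S)) ≡⟨ cong (8 *_) total ⟩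
    8 * ((2 + side m) * (2 + side m)) ∎
    where
    open ≤-Reasoning
    inner outer : (ℤ → ℤ → ℕ) → ℕ
    inner = squareSum (corner m) (side m)
    outer = squareSum (corner (suc m)) (side (suc m))
    boundary : (8 ∸ n) * inner (χ S) ≤ 8 * outer (χ (∁ S))
    boundary = begin
      (8 ∸ n) * inner (χ S)                         ≡⟨ squareSum-distribˡ-* (corner m) (side m) (8 ∸ n) (χ S) ⟨
      inner (λ x y → (8 ∸ n) * χ S x y)             ≤⟨ squareSum-mono (corner m) (side m) (boundary-lower S n sparse) ⟩
      inner (λ x y → χ S x y * N (∁ S) x y)         ≤⟨ double-counting-box (χ S) (χ (∁ S)) m ⟩
      outer (λ x y → χ (∁ S) x y * N S x y)         ≤⟨ squareSum-mono (corner (suc m)) (side (suc m)) (boundary-upper S) ⟩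
      outer (λ x y → 8 * χ (∁ S) x y)               ≡⟨ squareSum-distribˡ-* (corner (suc m)) (side (suc m)) 8 (χ (∁ S)) ⟩
      8 * outer (χ (∁ S))                           ∎
    total : outer (χ (∁ S)) + outer (χ S) ≡ (2 + side m) * (2 + side m)
    total = begin-equality
      outer (χ (∁ S)) + outer (χ S)                 ≡⟨ squareSum-distrib-+ (corner (suc m)) (side (suc m)) (χ (∁ S)) (χ S) ⟨
      outer (λ x y → χ (∁ S) x y + χ S x y)         ≡⟨ squareSum-cong (corner (suc m)) (side (suc m))
                                                         (λ x y → trans (+-comm (χ (∁ S) x y) (χ S x y)) (χ+χ∁≡1 S x y)) ⟩
      outer (λ _ _ → 1)                             ≡⟨ squareSum-const (corner (suc m)) (side (suc m)) 1 ⟩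
      side (suc m) * side (suc m) * 1               ≡⟨ *-identityʳ _ ⟩
      side (suc m) * side (suc m)                   ≡⟨ cong (λ k → k * k) (cong (suc ∘ suc) (+-suc m m)) ⟩
      (2 + side m) * (2 + side m)                   ∎

  sparse-upper-density : UpperDensity≤ S 8 (16 ∸ n)
  sparse-upper-density k = 4 * suc k , λ m 4K≤m →
    upper-density-from-bound k (∸-monoʳ-≤ 16 n≤8) (8K≤side m 4K≤m) (sparse-count-bound m)
    where
    8K≤side : ∀ m → 4 * suc k ≤ m → 8 * suc k ≤ side m
    8K≤side m 4K≤m = ≤-trans (≤-reflexive (*-distribʳ-+ (suc k) 4 4)) (≤-trans (+-mono-≤ 4K≤m 4K≤m) (n≤1+n (m + m)))

-- Periodic sets

module SquarePeriodic (S : SubsetZ²) (d : ℕ) (invˣ : Invariant S (+ suc d , + 0)) (invʸ : Invariant S (+ 0 , + suc d)) where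

  D : ℕ
  D = suc d

  σ τ : ℕ
  σ = squareSum (+ 0) D (χ S)
  τ = squareSum (+ 0) D (χ (∁ S))

  σ+τ≡D² : σ + τ ≡ D * D
  σ+τ≡D² = begin
    σ + τ                                              ≡⟨ squareSum-distrib-+ (+ 0) D (χ S) (χ (∁ S)) ⟨
    squareSum (+ 0) D (λ x y → χ S x y + χ (∁ S) x y)  ≡⟨ squareSum-cong (+ 0) D (χ+χ∁≡1 S) ⟩
    squareSum (+ 0) D (λ _ _ → 1)                      ≡⟨ squareSum-const (+ 0) D 1 ⟩
    D * D * 1                                          ≡⟨ *-identityʳ (D * D) ⟩
    D * D                                              ∎
    where open ≡-Reasoning

  χ-invˣ : Invariant (χ S) (+ D , + 0)
  χ-invˣ = Invariant-map bit invˣ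

  χ-invʸ : Invariant (χ S) (+ 0 , + D)
  χ-invʸ = Invariant-map bit invʸ

  σ≤D² : σ ≤ D * D
  σ≤D² = ≤-trans (m≤m+n σ τ) (≤-reflexive σ+τ≡D²)

  count-bounds : ∀ m → let q = side m / D in
    q * (q * σ) ≤ count S m × count S m ≤ q * (q * σ + D * D) + side m * D
  count-bounds m = lower , upper
    where
    open ≤-Reasoning
    a = corner m
    L = side m
    q = L / D
    row : ℤ → ℕ
    row x = intervalSum (+ 0) D (χ S x)
    row≤D : ∀ x → row x ≤ D
    row≤D x = ≤-trans (intervalSum-≤-const (+ 0) D 1 (χ S x) (χ≤1 S x)) (≤-reflexive (*-identityʳ D))
    in-row : ∀ x → q * row x ≤ intervalSum a L (χ S x) × intervalSum a L (χ S x) ≤ q * row x + D * 1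
    in-row x = intervalSum-periodic-bounds D (χ S x) (Invariant⇒periodicʸ χ-invʸ x) 1 (χ≤1 S x) a L
    across-rows : q * σ ≤ intervalSum a L row × intervalSum a L row ≤ q * σ + D * D
    across-rows = intervalSum-periodic-bounds D row (intervalSum-rows-periodic D (χ S) χ-invˣ (+ 0) D) D row≤D a L
    lower : q * (q * σ) ≤ count S m
    lower = begin
      q * (q * σ)                        ≤⟨ *-monoʳ-≤ q (proj₁ across-rows) ⟩
      q * intervalSum a L row            ≡⟨ ∑-distribˡ-* L q (λ i → row (a ℤ.+ + i)) ⟨
      intervalSum a L (λ x → q * row x)  ≤⟨ ∑-mono L (λ i → proj₁ (in-row (a ℤ.+ + i))) ⟩
      squareSum a L (χ S)                ≡⟨ count≡squareSum S m ⟨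
      count S m                          ∎
    upper : count S m ≤ q * (q * σ + D * D) + L * D
    upper = begin
      count S m                                         ≡⟨ count≡squareSum S m ⟩
      squareSum a L (χ S)                               ≤⟨ ∑-mono L (λ i → proj₂ (in-row (a ℤ.+ + i))) ⟩
      intervalSum a L (λ x → q * row x + D * 1)         ≡⟨ ∑-distrib-+ L (λ i → q * row (a ℤ.+ + i)) (λ _ → D * 1) ⟩
      intervalSum a L (λ x → q * row x) + intervalSum a L (λ _ → D * 1)
                                                        ≡⟨ cong₂ _+_ (∑-distribˡ-* L q (λ i → row (a ℤ.+ + i)))
                                                                     (trans (∑-const L (D * 1)) (cong (L *_) (*-identityʳ D))) ⟩
      q * intervalSum a L row + L * D                   ≤⟨ +-monoˡ-≤ (L * D) (*-monoʳ-≤ q (proj₂ across-rows)) ⟩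
      q * (q * σ + D * D) + L * D                       ∎

  quotient-bounds : ∀ L → L / D * D ≤ L × L ≤ L / D * D + D
  quotient-bounds L = m/n*n≤m L D , (begin
    L                    ≡⟨ m≡m%n+[m/n]*n L D ⟩
    L % D + L / D * D    ≤⟨ +-monoˡ-≤ (L / D * D) (<⇒≤ (m%n<n L D)) ⟩
    D + L / D * D        ≡⟨ +-comm D (L / D * D) ⟩
    L / D * D + D        ∎)
    where open ≤-Reasoning

  E : ℕ
  E = 2 * (D * (D * D))

  count-approx : ∀ m → let L = side m in
    count S m * (D * D) ≤ σ * (L * L) + L * E × σ * (L * L) ≤ count S m * (D * D) + L * E
  count-approx m =
      periodic-count-upper σ D (side m) q (proj₁ (quotient-bounds (side m))) (proj₂ (count-bounds m))
    , periodic-count-lower σ D (side m) q (proj₁ (quotient-bounds (side m))) σ≤D² (proj₂ (quotient-bounds (side m)))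
                           (proj₁ (count-bounds m))
    where q = side m / D

  density⇔ratio : ∀ p q → HasDensity S p q ⇔ q * σ ≡ p * (D * D)
  density⇔ratio p q = mk⇔ to from
    where
    from : q * σ ≡ p * (D * D) → HasDensity S p q
    from ratio k = 2 * D * suc k , λ m R≤m →
      density-from-ratio {p} {q} {count S m} {σ} {D * D} {side m * side m} {side m * E}
        (suc k) (proj₁ (count-approx m)) (proj₂ (count-approx m)) ratio
        (error-small (side m) (≤-trans R≤m (m≤side m)))
      where
      error-small : ∀ L → 2 * D * suc k ≤ L → suc k * (L * E) ≤ L * L * (D * D)
      error-small L 2DK≤L = begin
        suc k * (L * E)                ≡⟨ regroup (suc k) L D ⟩
        L * (2 * D * suc k) * (D * D)  ≤⟨ *-monoˡ-≤ (D * D) (*-monoʳ-≤ L 2DK≤L) ⟩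
        L * L * (D * D)                ∎
        where
        open ≤-Reasoning
        regroup : ∀ K L D → K * (L * (2 * (D * (D * D)))) ≡ L * (2 * D * K) * (D * D)
        regroup = solve-∀
    to : HasDensity S p q → q * σ ≡ p * (D * D)
    to dense with q * σ ≟ p * (D * D)
    ... | yes ratio = ratio
      -- With K = q D² + 1 the density inequalities force the side L of the box below K q E.
    ... | no ¬ratio = contradiction (≤-from-square-bound k L B bounded) (<⇒≱ B<L)
      where
      k = q * (D * D)
      B = suc k * q * E
      m = proj₁ (dense k) + B
      L = side m
      densities = proj₂ (dense k) m (m≤m+n _ B)
      bounded : suc k * (L * L) ≤ k * (L * L) + L * B
      bounded = ≤-trans (ratio-from-density {p} {q} {count S m} {σ} {D * D} {L * L} {L * E}
                          (suc k) (proj₁ (count-approx m)) (proj₂ (count-approx m))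
                          ¬ratio (proj₁ densities) (proj₂ densities))
                        (≤-reflexive (cong (λ z → k * (L * L) + z) (regroup (suc k) q L E)))
        where
        regroup : ∀ K q L E → K * q * (L * E) ≡ L * (K * q * E)
        regroup = solve-∀
      B<L : B < L
      B<L = s≤s (≤-trans (m≤n+m B _) (m≤m+n m m))

  χ∁-invˣ : Invariant (χ (∁ S)) (+ D , + 0)
  χ∁-invˣ = Invariant-map (bit ∘ not) invˣ

  χ∁-invʸ : Invariant (χ (∁ S)) (+ 0 , + D)
  χ∁-invʸ = Invariant-map (bit ∘ not) invʸ

  module _ (n : ℕ) (n≤8 : n ≤ 8) (sparse : ∀ x y → S x y ≡ true → N S x y ≤ n) where

    ratio⇔balanced : (16 ∸ n) * σ ≡ 8 * (D * D) ⇔ (8 ∸ n) * σ ≡ 8 * τ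
    ratio⇔balanced = mk⇔ (λ ratio → +-cancelʳ-≡ (8 * σ) _ _ (trans (sym lhs) (trans ratio rhs)))
                         (λ balanced → trans lhs (trans (cong (_+ 8 * σ) balanced) (sym rhs)))
      where
      lhs : (16 ∸ n) * σ ≡ (8 ∸ n) * σ + 8 * σ
      lhs = trans (cong (_* σ) (+-∸-comm 8 n≤8)) (*-distribʳ-+ σ (8 ∸ n) 8)
      rhs : 8 * (D * D) ≡ 8 * τ + 8 * σ
      rhs = trans (cong (8 *_) (trans (sym σ+τ≡D²) (+-comm σ τ))) (*-distribˡ-+ 8 τ σ)

    UpperTight LowerTight : Set
    UpperTight = ∀ x y → χ (∁ S) x y * N S x y ≡ 8 * χ (∁ S) x y
    LowerTight = ∀ x y → (8 ∸ n) * χ S x y ≡ χ S x y * N (∁ S) x y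

    balanced⇔tight : (8 ∸ n) * σ ≡ 8 * τ ⇔ (UpperTight × LowerTight)
    balanced⇔tight = mk⇔ to from
      where
      torus : (ℤ → ℤ → ℕ) → ℕ
      torus = squareSum (+ 0) D
      low≤mid : torus (λ x y → (8 ∸ n) * χ S x y) ≤ torus (λ x y → χ S x y * N (∁ S) x y)
      low≤mid = squareSum-mono (+ 0) D (boundary-lower S n sparse)
      mid≤high : torus (λ x y → χ (∁ S) x y * N S x y) ≤ torus (λ x y → 8 * χ (∁ S) x y)
      mid≤high = squareSum-mono (+ 0) D (boundary-upper S)
      mid≡mid : torus (λ x y → χ S x y * N (∁ S) x y) ≡ torus (λ x y → χ (∁ S) x y * N S x y)
      mid≡mid = double-counting-torus (χ S) (χ (∁ S)) D χ-invˣ χ-invʸ χ∁-invˣ χ∁-invʸ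
      low≡ : torus (λ x y → (8 ∸ n) * χ S x y) ≡ (8 ∸ n) * σ
      low≡ = squareSum-distribˡ-* (+ 0) D (8 ∸ n) (χ S)
      high≡ : torus (λ x y → 8 * χ (∁ S) x y) ≡ 8 * τ
      high≡ = squareSum-distribˡ-* (+ 0) D 8 (χ (∁ S))
      to : (8 ∸ n) * σ ≡ 8 * τ → UpperTight × LowerTight
      to balanced =
          ≗-from-fundamental-square D
            (Invariant-zip _*_ χ∁-invˣ (Invariant-nbrSum χ-invˣ)) (Invariant-zip _*_ χ∁-invʸ (Invariant-nbrSum χ-invʸ))
            (Invariant-map (8 *_) χ∁-invˣ) (Invariant-map (8 *_) χ∁-invʸ)
            (squareSum-≡⇒≗ (+ 0) D (boundary-upper S) mid≡high)
        , ≗-from-fundamental-square D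
            (Invariant-map ((8 ∸ n) *_) χ-invˣ) (Invariant-map ((8 ∸ n) *_) χ-invʸ)
            (Invariant-zip _*_ χ-invˣ (Invariant-nbrSum χ∁-invˣ)) (Invariant-zip _*_ χ-invʸ (Invariant-nbrSum χ∁-invʸ))
            (squareSum-≡⇒≗ (+ 0) D (boundary-lower S n sparse) low≡mid)
        where
        high≡low : torus (λ x y → 8 * χ (∁ S) x y) ≡ torus (λ x y → (8 ∸ n) * χ S x y)
        high≡low = trans high≡ (trans (sym balanced) (sym low≡))
        low≡mid : torus (λ x y → (8 ∸ n) * χ S x y) ≡ torus (λ x y → χ S x y * N (∁ S) x y)
        low≡mid = ≤-antisym low≤mid (≤-trans (≤-reflexive mid≡mid) (≤-trans mid≤high (≤-reflexive high≡low)))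
        mid≡high : torus (λ x y → χ (∁ S) x y * N S x y) ≡ torus (λ x y → 8 * χ (∁ S) x y)
        mid≡high = ≤-antisym mid≤high (≤-trans (≤-reflexive high≡low) (≤-trans low≤mid (≤-reflexive mid≡mid)))
      from : UpperTight × LowerTight → (8 ∸ n) * σ ≡ 8 * τ
      from (upper-tight , lower-tight) = begin
        (8 ∸ n) * σ                                 ≡⟨ low≡ ⟨
        torus (λ x y → (8 ∸ n) * χ S x y)           ≡⟨ squareSum-cong (+ 0) D lower-tight ⟩
        torus (λ x y → χ S x y * N (∁ S) x y)       ≡⟨ mid≡mid ⟩
        torus (λ x y → χ (∁ S) x y * N S x y)       ≡⟨ squareSum-cong (+ 0) D upper-tight ⟩
        torus (λ x y → 8 * χ (∁ S) x y)             ≡⟨ high≡ ⟩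
        8 * τ                                       ∎
        where open ≡-Reasoning

    density⇔extremal : HasDensity S 8 (16 ∸ n) ⇔
      ((∀ y₁ y₂ → S y₁ y₂ ≡ false → N S y₁ y₂ ≡ 8) × (∀ x₁ x₂ → S x₁ x₂ ≡ true → N S x₁ x₂ ≡ n))
    density⇔extremal =
      ⇔.trans (density⇔ratio 8 (16 ∸ n))
      (⇔.trans ratio⇔balanced
      (⇔.trans balanced⇔tight
               (boundary-upper-≡⇔ S ×-⇔ boundary-lower-≡⇔ S n n≤8)))

proposition1 : (n : ℕ) → n ≤ 8 →
    ((S : SubsetZ²) → (∀ (x₁ x₂ : ℤ) → S x₁ x₂ ≡ true → N S x₁ x₂ ≤ n) →
      UpperDensity≤ S 8 (16 ∸ n))
    ×
    ((S : SubsetZ²) → Periodic S →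
      (∀ (x₁ x₂ : ℤ) → S x₁ x₂ ≡ true → N S x₁ x₂ ≤ n) →
      (HasDensity S 8 (16 ∸ n) ⇔
        ((∀ (y₁ y₂ : ℤ) → S y₁ y₂ ≡ false → N S y₁ y₂ ≡ 8) ×
         (∀ (x₁ x₂ : ℤ) → S x₁ x₂ ≡ true → N S x₁ x₂ ≡ n))))
proposition1 n n≤8 =
    (λ S sparse → sparse-upper-density S n n≤8 sparse)
  , (λ S periodic sparse →
       let d , invˣ , invʸ = periodic⇒square-period S periodic
       in  SquarePeriodic.density⇔extremal S d invˣ invʸ n n≤8 sparse)
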